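{- Consider a complete phase of $\mathrm{ALG}_i$, $i\ge2$. For any point $p\in M_i$, there exists a subphase of this phase in which at most a $1/c(i)$ fraction of the requests $r$ satisfy $r(i)=p$.
   Context: Generalized $k$-server on weighted uniform metrics: server $s_i$ lives in a uniform metric $M_i$ with all pairwise distances $w_i$; a request is $r=(r(1),\dots,r(k))$ with $r(i)\in M_i$ and is served if some $s_i$ is at $r(i)$; moving $s_i$ costs $w_i$. Set $c(i)=2^{2^{i+1}-3}$. Standing assumptions: $w_1=1$; for $2\le i\le k$, $w_i$ is an integer multiple of $2(1+c(i-1))w_{i-1}$; $|M_i|\ge c(i)$; and every request presented to $\mathrm{ALG}_i$ is not satisfied by the current positions of its servers $s_1,\dots,s_i$ (so it moves a server at every request). Algorithms $\mathrm{ALG}_i$ (using $s_1,\dots,s_i$) work in phases. $\mathrm{ALG}_1$: on each request move $s_1$ to the requested point; a phase is 6 requests. $\mathrm{ALG}_i$, $i\ge2$: a phase consists of $c(i)+1$ subphases. First move $s_i$ to an arbitrary point of $M_i$ and run $\mathrm{ALG}_{i-1}$ (started afresh) until the cost incurred by $\mathrm{ALG}_{i-1}$ equals exactly $w_i$ (learning subphase). For $p\in M_i$ let $m(p)$ be the number of learning-subphase requests with $r(i)=p$, and let $P$ be a set of $c(i)$ points with largest counts (ties broken arbitrarily). Then $c(i)$ times: move $s_i$ to a point of $P$ not yet visited in this phase and run $\mathrm{ALG}_{i-1}$ until its cost in this subphase equals $w_i$. A phase is complete if all its subphases are finished. -}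

module Defs where

open import Data.Nat using (ℕ; zero; suc; _+_; _*_; _∸_; _^_; _≤_; _<_)
import Data.Nat as N
open import Data.Fin using (Fin)
import Data.Fin as F
open import Data.List using (List; []; _∷_; _++_; length; filter; concat)
open import Data.List.Membership.Propositional using (_∈_; _∉_)
open import Data.List.Relation.Unary.Unique.Propositional using (Unique)
open import Relation.Binary.PropositionalEquality using (_≡_; refl)
open import Relation.Nullary using (¬_; yes; no)

c : ℕ → ℕ
c i = 2 ^ (2 ^ (i + 1) ∸ 3)

-- Semantics of the algorithms ALG_l.
--   sz l : number of points of the uniform metric M_l (points are Fin (sz l))
--   w  l : the weight w_l of M_l
--   t    : the index of the top-level algorithm ALG_t; every request presented
--          to it is unsatisfied by the current positions of s_1 .. s_t.
-- Servers / coordinates are indexed 1-based by ℕ; coordinates outside the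
-- relevant range are simply never read by ALG_l.
module Semantics (sz : ℕ → ℕ) (w : ℕ → ℕ) (t : ℕ) where

  Pt : ℕ → Set
  Pt l = Fin (sz l)

  -- positions of the servers: s_l is at C l
  Config : Set
  Config = (l : ℕ) → Pt l

  Req : Set
  Req = (l : ℕ) → Pt l

  Unsat : Config → Req → Set
  Unsat C r = (l : ℕ) → 1 ≤ l → l ≤ t → ¬ (r l ≡ C l)

  upd : Config → (l : ℕ) → Pt l → Config
  upd C l p j with j N.≟ l
  ... | yes refl = p
  ... | no _ = C j

  moveCost : Config → (l : ℕ) → Pt l → ℕ
  moveCost C l p with C l F.≟ p
  ... | yes _ = 0
  ... | no _ = w l

  count : (l : ℕ) → Pt l → List Req → ℕ
  count l p rs = length (filter (λ r → r l F.≟ p) rs)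

  TopCounts : (l : ℕ) → List Req → List (Pt l) → Set
  TopCounts l rs P = (p q : Pt l) → p ∈ P → q ∉ P → count l q rs ≤ count l p rs

  data Steps1 : Config → List Req → Config → ℕ → Set where
    stop : ∀ {C} → Steps1 C [] C 0
    step : ∀ {C r rs C' x} → Unsat C r →
           Steps1 (upd C 1 (r 1)) rs C' x →
           Steps1 C (r ∷ rs) C' (moveCost C 1 (r 1) + x)

  mutual
    -- Exec l C rs C' x : ALG_l, started afresh in configuration C, serves
    -- the request sequence rs (a number of complete phases followed by a
    -- possibly empty prefix of a phase), ending in C' with total cost x.
    data Exec : ℕ → Config → List Req → Config → ℕ → Set where
      done : ∀ {l C rs C' x} → Partial l C rs C' x → Exec l C rs C' x
      more : ∀ {l C rs C₁ x rs' C' y} → Phase l C rs C₁ x →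
             Exec l C₁ rs' C' y → Exec l C (rs ++ rs') C' (x + y)

    data Phase : ℕ → Config → List Req → Config → ℕ → Set where
      phase1 : ∀ {C rs C' x} → Steps1 C rs C' x → length rs ≡ 6 →
               Phase 1 C rs C' x
      phaseS : ∀ {j C rss C' x} → PhaseSub (suc (suc j)) C rss C' x →
               Phase (suc (suc j)) C (concat rss) C' x

    -- a complete phase of ALG_l (l ≥ 2), indexed by the list of the request
    -- sequences of its c(l)+1 subphases (learning subphase first)
    data PhaseSub : ℕ → Config → List (List Req) → Config → ℕ → Set where
      mkPhase : ∀ {j C rs₀ C₁ x₀ rss C' y} →
        let l = suc (suc j) in
        (q₀ : Pt l) →                              -- arbitrary point for the learning subphase
        Subphase l q₀ C rs₀ C₁ x₀ →
        (P : List (Pt l)) → length P ≡ c l → Unique P →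
        TopCounts l rs₀ P →
        Chain l P C₁ rss C' y →
        PhaseSub l C (rs₀ ∷ rss) C' (x₀ + y)

    data Chain : (l : ℕ) → List (Pt l) → Config → List (List Req) → Config → ℕ → Set where
      cnil  : ∀ {l C} → Chain l [] C [] C 0
      ccons : ∀ {l q qs C rs C₁ x rss C' y} →
              Subphase l q C rs C₁ x → Chain l qs C₁ rss C' y →
              Chain l (q ∷ qs) C (rs ∷ rss) C' (x + y)

    -- a complete subphase of ALG_(j+2): move s_(j+2) to q, then run
    -- ALG_(j+1) afresh until its cost equals exactly w_(j+2)
    data Subphase : (l : ℕ) → Pt l → Config → List Req → Config → ℕ → Set where
      mkSub : ∀ {j q C rs C'} →
              Exec (suc j) (upd C (suc (suc j)) q) rs C' (w (suc (suc j))) →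
              Subphase (suc (suc j)) q C rs C'
                (moveCost C (suc (suc j)) q + w (suc (suc j)))

    -- a proper prefix of a subphase (possibly empty)
    data PartialSub : (l : ℕ) → Pt l → Config → List Req → Config → ℕ → Set where
      psEmpty : ∀ {l q C} → PartialSub l q C [] C 0
      psRun   : ∀ {j q C r rs C' y} →
                Exec (suc j) (upd C (suc (suc j)) q) (r ∷ rs) C' y →
                y < w (suc (suc j)) →
                PartialSub (suc (suc j)) q C (r ∷ rs) C'
                  (moveCost C (suc (suc j)) q + y)

    -- a proper prefix of a phase (possibly empty)
    data Partial : ℕ → Config → List Req → Config → ℕ → Set where
      partial1 : ∀ {C rs C' x} → Steps1 C rs C' x → length rs < 6 →
                 Partial 1 C rs C' x
      pLearn : ∀ {j q₀ C rs C' x} → PartialSub (suc (suc j)) q₀ C rs C' x →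
               Partial (suc (suc j)) C rs C' x
      pMid : ∀ {j C rs₀ C₁ x₀ rss C₂ y rs C' z} →
        let l = suc (suc j) in
        (q₀ : Pt l) → Subphase l q₀ C rs₀ C₁ x₀ →
        (P : List (Pt l)) → length P ≡ c l → Unique P →
        TopCounts l rs₀ P →
        (Pdone : List (Pt l)) (q : Pt l) (Prest : List (Pt l)) →
        P ≡ Pdone ++ (q ∷ Prest) →
        Chain l Pdone C₁ rss C₂ y →
        PartialSub l q C₂ rs C' z →
        Partial l C (rs₀ ++ (concat rss ++ rs)) C' (x₀ + (y + z))

-- Let P be the c(i) points chosen after the learning subphase.
--   * If p ∈ P, take the subphase that parks s_i at p.  Inside a subphase only
--     servers s_1 .. s_(i-1) move, so s_i stays at p; since every request is
--     unsatisfied by s_i, no request of that subphase has r(i) = p.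
--   * If p ∉ P, take the learning subphase.  Every q ∈ P is requested at least
--     as often as p there, and the counts of the c(i) distinct points of P add
--     up to at most the number of requests, so c(i)·m(p) ≤ #requests.
module Submission where

open import Defs
open import Data.Nat using (ℕ; _+_; _*_; _∸_; _≤_)
open import Data.Product using (Σ; ∃; _×_)
open import Data.List using (List; length)
open import Data.List.Membership.Propositional using (_∈_)
open import Relation.Binary.PropositionalEquality using (_≡_)

open import Data.Nat using (suc; _<_; z≤n)
import Data.Nat as Nat
open import Data.Nat.Properties
  using (≤-refl; ≤-trans; ≤-reflexive; +-suc; +-mono-≤; *-zeroʳ; n<1+n; <-trans; <⇒≢; <⇒≤;
         module ≤-Reasoning)
open import Data.Nat.ListAction using (sum)
import Data.Fin as F
open import Data.Product using (_,_; proj₁)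
open import Data.List using ([]; _∷_; _++_; concat; map; filter)
open import Data.List.Properties using (filter-none)
open import Data.List.Relation.Unary.All using (All; []; _∷_; tabulate)
open import Data.List.Relation.Unary.All.Properties using (++⁺)
open import Data.List.Relation.Unary.Any using (here; there)
open import Data.List.Relation.Unary.AllPairs using ([]; _∷_)
open import Data.List.Relation.Unary.Unique.Propositional using (Unique)
import Data.List.Membership.DecPropositional as DecMembership
open import Relation.Binary.Definitions using (DecidableEquality)
open import Relation.Binary.PropositionalEquality using (refl; sym; trans; cong; cong₂; subst; _≢_; ≢-sym)
open import Relation.Nullary using (yes; no; ¬?)
open import Data.Empty using (⊥-elim)
open import Function using (case_of_)

module Occurrences {a b} {A : Set a} {X : Set b}
                   (_≟_ : DecidableEquality A) (key : X → A) where

  occ : A → List X → ℕ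
  occ q xs = length (filter (λ x → key x ≟ q) xs)

  others : A → List X → List X
  others q xs = filter (λ x → ¬? (key x ≟ q)) xs

  occ-split : ∀ q xs → occ q xs + length (others q xs) ≡ length xs
  occ-split q [] = refl
  occ-split q (x ∷ xs) with key x ≟ q
  ... | yes _ = cong suc (occ-split q xs)
  ... | no _ = trans (+-suc (occ q xs) _) (cong suc (occ-split q xs))

  occ-others : ∀ {q q'} → q ≢ q' → ∀ xs → occ q' (others q xs) ≡ occ q' xs
  occ-others q≢q' [] = refl
  occ-others {q} {q'} q≢q' (x ∷ xs) with key x ≟ q
  ... | yes refl with key x ≟ q'
  ...   | yes refl = ⊥-elim (q≢q' refl)
  ...   | no _     = occ-others q≢q' xs
  occ-others {q} {q'} q≢q' (x ∷ xs) | no _ with key x ≟ q'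
  ...   | yes _ = cong suc (occ-others q≢q' xs)
  ...   | no _  = occ-others q≢q' xs

  occ-none : ∀ {q xs} → All (λ x → key x ≢ q) xs → occ q xs ≡ 0
  occ-none {q} none = cong length (filter-none (λ x → key x ≟ q) none)

  sum-occ≤length : ∀ {P} → Unique P → ∀ xs → sum (map (λ q → occ q xs) P) ≤ length xs
  sum-occ≤length [] xs = z≤n
  sum-occ≤length {q ∷ P} (q∉P ∷ uniq) xs = begin
    occ q xs + sum (map (λ q' → occ q' xs) P)
      ≡⟨ cong (occ q xs +_) (sym (sum-others q∉P)) ⟩
    occ q xs + sum (map (λ q' → occ q' (others q xs)) P)
      ≤⟨ +-mono-≤ ≤-refl (sum-occ≤length uniq (others q xs)) ⟩
    occ q xs + length (others q xs)
      ≡⟨ occ-split q xs ⟩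
    length xs ∎
    where
    open ≤-Reasoning
    sum-others : ∀ {P} → All (q ≢_) P →
                 sum (map (λ q' → occ q' (others q xs)) P) ≡ sum (map (λ q' → occ q' xs) P)
    sum-others [] = refl
    sum-others (q≢q' ∷ rest) =
      cong₂ _+_ (occ-others q≢q' xs) (sum-others rest)

  dominated-occ : ∀ {P} → Unique P → ∀ p xs → (∀ {q} → q ∈ P → occ p xs ≤ occ q xs) →
                  length P * occ p xs ≤ length xs
  dominated-occ {P} uniq p xs dom =
    ≤-trans (length*≤sum P (tabulate dom)) (sum-occ≤length uniq xs)
    where
    length*≤sum : ∀ Q → All (λ q → occ p xs ≤ occ q xs) Q →
                  length Q * occ p xs ≤ sum (map (λ q → occ q xs) Q)
    length*≤sum [] [] = z≤n
    length*≤sum (q ∷ Q) (le ∷ les) = +-mono-≤ le (length*≤sum Q les)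

module Runs (sz w : ℕ → ℕ) (t : ℕ) where
  open Semantics sz w t

  upd-same : ∀ (C : Config) l (p : Pt l) → upd C l p l ≡ p
  upd-same C l p with l Nat.≟ l
  ... | yes refl = refl
  ... | no l≢l = ⊥-elim (l≢l refl)

  upd-other : ∀ (C : Config) m (p : Pt m) l → l ≢ m → upd C m p l ≡ C l
  upd-other C m p l l≢m with l Nat.≟ m
  ... | yes refl = ⊥-elim (l≢m refl)
  ... | no _ = refl

  -- While ALG_m with m < l runs, server s_l (l ≤ t) never moves.  If it is
  -- parked at v, then no request of the run has r(l) = v, because every
  -- request is unsatisfied by s_1 .. s_t.
  module Parking (l : ℕ) (v : Pt l) (l≤t : l ≤ t) where

    record Parked (D : Config) (rs : List Req) (D' : Config) : Set where
      constructor parked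
      field stays : D l ≡ v → All (λ r → r l ≢ v) rs × D' l ≡ v
    open Parked public

    parked-[] : ∀ {D} → Parked D [] D
    parked-[] = parked λ at → [] , at

    parked-++ : ∀ {D rs D₁ rs' D'} → Parked D rs D₁ → Parked D₁ rs' D' → Parked D (rs ++ rs') D'
    parked-++ first second = parked λ at →
      let (avoid , at₁) = stays first at
          (avoid' , at') = stays second at₁
      in ++⁺ avoid avoid' , at'

    parked-upd : ∀ {D m q rs D'} → m < l → Parked (upd D m q) rs D' → Parked D rs D'
    parked-upd {D} {m} {q} m<l run =
      parked λ at → stays run (trans (upd-other D m q l (≢-sym (<⇒≢ m<l))) at)

    steps-parked : ∀ {D rs D' y} → 1 < l → Steps1 D rs D' y → Parked D rs D'
    steps-parked 1<l stop = parked-[]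
    steps-parked 1<l (step unsat steps) = parked λ at →
      let (avoid , at') = stays (parked-upd 1<l (steps-parked 1<l steps)) at
      in (λ r≡v → unsat l (<⇒≤ 1<l) l≤t (trans r≡v (sym at))) ∷ avoid , at'

    -- every kind of run of ALG_m (m < l) is a concatenation of such runs, with
    -- extra moves only of servers s_(m') for m' ≤ m
    mutual
      exec-parked : ∀ {m D rs D' y} → m < l → Exec m D rs D' y → Parked D rs D'
      exec-parked m<l (done run) = partial-parked m<l run
      exec-parked m<l (more ph run) = parked-++ (phase-parked m<l ph) (exec-parked m<l run)

      phase-parked : ∀ {m D rs D' y} → m < l → Phase m D rs D' y → Parked D rs D'
      phase-parked m<l (phase1 steps _) = steps-parked m<l steps
      phase-parked m<l (phaseS ph) = phaseSub-parked m<l ph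

      phaseSub-parked : ∀ {m D rss D' y} → m < l → PhaseSub m D rss D' y → Parked D (concat rss) D'
      phaseSub-parked m<l (mkPhase _ learn _ _ _ _ chain) =
        parked-++ (subphase-parked m<l learn) (chain-parked m<l chain)

      chain-parked : ∀ {m P D rss D' y} → m < l → Chain m P D rss D' y → Parked D (concat rss) D'
      chain-parked m<l cnil = parked-[]
      chain-parked m<l (ccons sub chain) =
        parked-++ (subphase-parked m<l sub) (chain-parked m<l chain)

      subphase-parked : ∀ {m q D rs D' y} → m < l → Subphase m q D rs D' y → Parked D rs D'
      subphase-parked m<l (mkSub run) = parked-upd m<l (exec-parked (<-trans (n<1+n _) m<l) run)

      partialSub-parked : ∀ {m q D rs D' y} → m < l → PartialSub m q D rs D' y → Parked D rs D'
      partialSub-parked m<l psEmpty = parked-[]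
      partialSub-parked m<l (psRun run _) = parked-upd m<l (exec-parked (<-trans (n<1+n _) m<l) run)

      partial-parked : ∀ {m D rs D' y} → m < l → Partial m D rs D' y → Parked D rs D'
      partial-parked m<l (partial1 steps _) = steps-parked m<l steps
      partial-parked m<l (pLearn run) = partialSub-parked m<l run
      partial-parked m<l (pMid _ learn _ _ _ _ _ _ _ _ chain run) =
        parked-++ (subphase-parked m<l learn)
                  (parked-++ (chain-parked m<l chain) (partialSub-parked m<l run))

  subphase-avoids : ∀ {l q D rs D' x} → l ≤ t → Subphase l q D rs D' x → All (λ r → r l ≢ q) rs
  subphase-avoids {D = D} l≤t (mkSub {j} {q} run) =
    proj₁ (Parking.stays (Parking.exec-parked (suc (suc j)) q l≤t (n<1+n _) run)
                         (upd-same D (suc (suc j)) q))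

  chain-subphase : ∀ {l P D rss D' y q} → Chain l P D rss D' y → q ∈ P →
                   Σ (List Req) λ rs → rs ∈ rss × ∃ λ D₁ → ∃ λ D₂ → ∃ λ x → Subphase l q D₁ rs D₂ x
  chain-subphase (ccons sub chain) (here refl) = _ , here refl , _ , _ , _ , sub
  chain-subphase (ccons sub chain) (there q∈P) =
    let (rs , rs∈rss , sub') = chain-subphase chain q∈P in rs , there rs∈rss , sub'

lemma5 : (k : ℕ) (sz w : ℕ → ℕ) →
    w 1 ≡ 1 →
    ((l : ℕ) → 2 ≤ l → l ≤ k →
    ∃ λ m → w l ≡ m * (2 * (1 + c (l ∸ 1)) * w (l ∸ 1))) →
    ((l : ℕ) → 1 ≤ l → l ≤ k → c l ≤ sz l) →
    (i : ℕ) → 2 ≤ i → i ≤ k →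
    (C : Semantics.Config sz w i) (rss : List (List (Semantics.Req sz w i)))
    (C' : Semantics.Config sz w i) (x : ℕ) →
    Semantics.PhaseSub sz w i i C rss C' x →
    (p : Semantics.Pt sz w i i) →
    Σ (List (Semantics.Req sz w i)) λ rs →
    rs ∈ rss × c i * Semantics.count sz w i i p rs ≤ length rs
lemma5 _ sz w _ _ _ i _ _ _ _ _ _ (Semantics.mkPhase {rs₀ = learned} _ _ P |P|≡c uniq top chain) p =
  case DecMembership._∈?_ F._≟_ p P of λ where
    -- the subphase that parks s_i at p contains no request with r(i) = p
    (yes p∈P) →
      let (rs , rs∈rss , _ , _ , _ , sub) = Runs.chain-subphase sz w i chain p∈P
          none = occ-none (Runs.subphase-avoids sz w i ≤-refl sub)
      in rs , there rs∈rss , ≤-trans (≤-reflexive (trans (cong (c i *_) none) (*-zeroʳ (c i)))) z≤n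
    -- in the learning subphase every point of P is requested at least as often as p
    (no p∉P) →
      learned , here refl ,
      subst (λ n → n * occ p learned ≤ length learned) |P|≡c
            (dominated-occ uniq p learned (λ {q} q∈P → top q p q∈P p∉P))
  where open Occurrences (F._≟_ {sz i}) (λ (r : Semantics.Req sz w i) → r i)
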